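{- Let $n\geq 1$. Every element of $R^{\mathrm{J}}_n$ other than $0^n$ and $1^n$ has finite block code.
   Context: Bitstrings $x\in\{0,1\}^n$; $\sigma(x_1\cdots x_n)=x_nx_1\cdots x_{n-1}$; the necklace of $x$ is $\langle x\rangle=\{\sigma^i(x):i\ge0\}$. Reading 0 as an opening and 1 as a closing parenthesis and matching closest pairs in the usual way, $U_1(x)$ is the set of positions of unmatched 1s. $R^{\mathrm{J}}_n$ is the set of bitstrings $x$ such that $|U_1(x)|$ is maximum among all elements of $\langle x\rangle$. The block code of $x$ is finite if $x=1^{a_1}0^{b_1}\cdots1^{a_r}0^{b_r}$ for some $r\ge1$ and all $a_i,b_i\ge1$ (equivalently, $x_1=1$ and $x_n=0$). -}

module Defs where

open import Data.Bool using (Bool; true; false)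
open import Data.Nat using (ℕ; zero; suc; _≤_; _<_)
open import Data.List using (List; []; _∷_; length)
open import Data.Vec using (Vec; []; _∷_; _∷ʳ_; head; last; init; replicate)
open import Data.Product using (∃; _×_)
open import Relation.Binary.PropositionalEquality using (_≡_)
open import Relation.Nullary using (¬_)

-- A bitstring of length n; `false` is the bit 0, `true` is the bit 1.
Bits : ℕ → Set
Bits n = Vec Bool n

σ : ∀ {n} → Bits n → Bits n
σ {zero}  []       = []
σ {suc n} (b ∷ xs) = last (b ∷ xs) ∷ init (b ∷ xs)

σ^ : ∀ {n} → ℕ → Bits n → Bits n
σ^ zero    x = x
σ^ (suc i) x = σ (σ^ i x)

-- Parenthesis matching: 0 = "(", 1 = ")".  Scan left to right keeping the
-- number of currently unmatched 0s (a stack); a 1 matches the closest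
-- unmatched 0 to its left if there is one, otherwise it is unmatched.
-- `U₁-from pos k x` lists the (1-based) positions of unmatched 1s.
U₁-from : ∀ {n} → ℕ → ℕ → Bits n → List ℕ
U₁-from pos k []            = []
U₁-from pos k (false ∷ xs)  = U₁-from (suc pos) (suc k) xs
U₁-from pos zero (true ∷ xs)   = pos ∷ U₁-from (suc pos) zero xs
U₁-from pos (suc k) (true ∷ xs) = U₁-from (suc pos) k xs

U₁ : ∀ {n} → Bits n → List ℕ
U₁ x = U₁-from 1 0 x

_∈⟨_⟩ : ∀ {n} → Bits n → Bits n → Set
y ∈⟨ x ⟩ = ∃ λ i → y ≡ σ^ i x

RJ : (n : ℕ) → Bits n → Set
RJ n x = ∀ (y : Bits n) → y ∈⟨ x ⟩ → length (U₁ y) ≤ length (U₁ x)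

-- Finite block code: x = 1^{a₁}0^{b₁}⋯1^{a_r}0^{b_r}, r ≥ 1, aᵢ,bᵢ ≥ 1;
-- equivalently (as stated in the paper) x₁ = 1 and xₙ = 0.
FiniteBlockCode : ∀ {n} → Bits (suc n) → Set
FiniteBlockCode x = (head x ≡ true) × (last x ≡ false)

-- If x = 0^{a+1} 1 v, moving the leading
-- zeros to the back frees the first 1, which they used to match, and the
-- trailing zeros match nothing; so the rotation has more unmatched 1s than x.
-- If x = v 0 1^{a+1}, moving the trailing ones to the front makes all a+1 of
-- them unmatched, whereas in x the 0 before them matches one.  Either way x is
-- not maximal in its necklace.
module Submission where

open import Defs
open import Data.Bool using (Bool; true; false)
open import Data.Nat using (ℕ; zero; suc; _+_; _≤_; _<_; z≤n; s≤s)
open import Data.Nat.Properties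
  using (≤-refl; ≤-trans; n≤1+n; n<1+n; +-comm; +-suc; +-monoʳ-≤; <⇒≱; module ≤-Reasoning)
open import Data.List as List using (List; []; _∷_; _++_; [_]; _∷ʳ_; length)
open import Data.List.Properties using (++-assoc; ++-identityʳ; ∷ʳ-injective; ∷ʳ-++)
open import Data.Vec as Vec using (replicate; toList; head; last; init; initLast)
open import Data.Vec.Properties using (toList-∷ʳ; toList-replicate)
open import Data.Product using (_,_; ∃₂; _×_; proj₂)
open import Data.Sum using (_⊎_; inj₁; inj₂)
open import Data.Empty using (⊥-elim)
open import Relation.Binary.PropositionalEquality
  using (_≡_; refl; sym; trans; cong; cong₂; subst₂; module ≡-Reasoning)
open import Relation.Nullary using (¬_)

unmatched : ℕ → List Bool → ℕ
unmatched k       []           = 0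
unmatched k       (false ∷ xs) = unmatched (suc k) xs
unmatched zero    (true ∷ xs)  = suc (unmatched zero xs)
unmatched (suc k) (true ∷ xs)  = unmatched k xs

length-U₁-from : ∀ {n} pos k (x : Bits n) → length (U₁-from pos k x) ≡ unmatched k (toList x)
length-U₁-from pos k       Vec.[]           = refl
length-U₁-from pos k       (false Vec.∷ x)  = length-U₁-from (suc pos) (suc k) x
length-U₁-from pos zero    (true Vec.∷ x)   = cong suc (length-U₁-from (suc pos) zero x)
length-U₁-from pos (suc k) (true Vec.∷ x)   = length-U₁-from (suc pos) k x

unmatched-suc-≤ : ∀ k xs → unmatched (suc k) xs ≤ unmatched k xs
unmatched-suc-≤ k       []           = z≤n
unmatched-suc-≤ k       (false ∷ xs) = unmatched-suc-≤ (suc k) xs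
unmatched-suc-≤ zero    (true ∷ xs)  = n≤1+n _
unmatched-suc-≤ (suc k) (true ∷ xs)  = unmatched-suc-≤ k xs

unmatched-≤-unmatched₀ : ∀ k xs → unmatched k xs ≤ unmatched 0 xs
unmatched-≤-unmatched₀ zero    xs = ≤-refl
unmatched-≤-unmatched₀ (suc k) xs = ≤-trans (unmatched-suc-≤ k xs) (unmatched-≤-unmatched₀ k xs)

unmatched-++-≥ : ∀ k xs ys → unmatched k xs ≤ unmatched k (xs ++ ys)
unmatched-++-≥ k       []           ys = z≤n
unmatched-++-≥ k       (false ∷ xs) ys = unmatched-++-≥ (suc k) xs ys
unmatched-++-≥ zero    (true ∷ xs)  ys = s≤s (unmatched-++-≥ zero xs ys)
unmatched-++-≥ (suc k) (true ∷ xs)  ys = unmatched-++-≥ k xs ys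

unmatched-++-≤ : ∀ k xs ys → unmatched k (xs ++ ys) ≤ unmatched k xs + unmatched 0 ys
unmatched-++-≤ k       []           ys = unmatched-≤-unmatched₀ k ys
unmatched-++-≤ k       (false ∷ xs) ys = unmatched-++-≤ (suc k) xs ys
unmatched-++-≤ zero    (true ∷ xs)  ys = s≤s (unmatched-++-≤ zero xs ys)
unmatched-++-≤ (suc k) (true ∷ xs)  ys = unmatched-++-≤ k xs ys

unmatched-zeros-++ : ∀ m k xs → unmatched k (List.replicate m false ++ xs) ≡ unmatched (m + k) xs
unmatched-zeros-++ zero    k xs = refl
unmatched-zeros-++ (suc m) k xs =
  trans (unmatched-zeros-++ m (suc k) xs) (cong (λ j → unmatched j xs) (+-suc m k))

unmatched-ones-++ : ∀ m xs → unmatched 0 (List.replicate m true ++ xs) ≡ m + unmatched 0 xs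
unmatched-ones-++ zero    xs = refl
unmatched-ones-++ (suc m) xs = cong suc (unmatched-ones-++ m xs)

unmatched-ones : ∀ m → unmatched 0 (List.replicate m true) ≡ m
unmatched-ones zero    = refl
unmatched-ones (suc m) = cong suc (unmatched-ones m)

head-≡ : ∀ {n} (x : Bits (suc n)) {b xs} → toList x ≡ b ∷ xs → head x ≡ b
head-≡ (_ Vec.∷ _) refl = refl

toList-init-last : ∀ {n} (x : Bits (suc n)) → toList x ≡ toList (init x) ∷ʳ last x
toList-init-last x = trans (cong toList (proj₂ (proj₂ (initLast x)))) (toList-∷ʳ (last x) (init x))

toList-≡-∷ʳ : ∀ {n} (x : Bits (suc n)) {xs b} → toList x ≡ xs ∷ʳ b →
              toList (init x) ≡ xs × last x ≡ b
toList-≡-∷ʳ x {xs} eq = ∷ʳ-injective (toList (init x)) xs (trans (sym (toList-init-last x)) eq)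

toList-σ-∷ʳ : ∀ {n} (x : Bits (suc n)) {xs b} → toList x ≡ xs ∷ʳ b → toList (σ x) ≡ b ∷ xs
toList-σ-∷ʳ x@(_ Vec.∷ _) eq with toList-≡-∷ʳ x eq
... | init≡ , last≡ = cong₂ _∷_ last≡ init≡

toList-σ^-++ : ∀ {n} (x : Bits (suc n)) xs ys → toList x ≡ xs ++ ys →
               toList (σ^ (length ys) x) ≡ ys ++ xs
toList-σ^-++ x xs []       eq = trans eq (++-identityʳ xs)
toList-σ^-++ x xs (y ∷ ys) eq = toList-σ-∷ʳ (σ^ (length ys) x) (begin
    toList (σ^ (length ys) x)  ≡⟨ toList-σ^-++ x (xs ∷ʳ y) ys (trans eq (sym (∷ʳ-++ xs y ys))) ⟩
    ys ++ xs ∷ʳ y              ≡⟨ sym (++-assoc ys xs [ y ]) ⟩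
    (ys ++ xs) ∷ʳ y            ∎)
  where open ≡-Reasoning

RJ-rotate : ∀ {n} {x : Bits (suc n)} → RJ (suc n) x → ∀ xs ys → toList x ≡ xs ++ ys →
            unmatched 0 (ys ++ xs) ≤ unmatched 0 (xs ++ ys)
RJ-rotate {x = x} rj xs ys eq =
  subst₂ _≤_ (trans (length-U₁-from 1 0 y) (cong (unmatched 0) (toList-σ^-++ x xs ys eq)))
             (trans (length-U₁-from 1 0 x) (cong (unmatched 0) eq))
             (rj y (length ys , refl))
  where y = σ^ (length ys) x

replicate-⊎-leading-zeros : ∀ {n} (x : Bits n) →
  x ≡ replicate n false ⊎ ∃₂ λ a ys → toList x ≡ List.replicate a false ++ true ∷ ys
replicate-⊎-leading-zeros Vec.[] = inj₁ refl
replicate-⊎-leading-zeros (true Vec.∷ x) = inj₂ (0 , toList x , refl)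
replicate-⊎-leading-zeros (false Vec.∷ x) with replicate-⊎-leading-zeros x
... | inj₁ refl            = inj₁ refl
... | inj₂ (a , ys , eq) = inj₂ (suc a , ys , cong (false ∷_) eq)

replicate-⊎-trailing-ones : ∀ {n} (x : Bits n) →
  x ≡ replicate n true ⊎ ∃₂ λ xs a → toList x ≡ xs ++ false ∷ List.replicate a true
replicate-⊎-trailing-ones Vec.[] = inj₁ refl
replicate-⊎-trailing-ones (b Vec.∷ x) with replicate-⊎-trailing-ones x
replicate-⊎-trailing-ones (b Vec.∷ x) | inj₂ (xs , a , eq) = inj₂ (b ∷ xs , a , cong (b ∷_) eq)
replicate-⊎-trailing-ones (true Vec.∷ x) | inj₁ refl = inj₁ refl
replicate-⊎-trailing-ones {suc n} (false Vec.∷ x) | inj₁ refl =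
  inj₂ ([] , n , cong (false ∷_) (toList-replicate n true))

RJ-¬leading-zeros : ∀ {n} {x : Bits (suc n)} → RJ (suc n) x →
                    ∀ a ys → ¬ (toList x ≡ List.replicate (suc a) false ++ true ∷ ys)
RJ-¬leading-zeros rj a ys eq = <⇒≱ fewer (RJ-rotate rj zeros (true ∷ ys) eq)
  where
  open ≤-Reasoning
  zeros = List.replicate (suc a) false
  fewer : unmatched 0 (zeros ++ true ∷ ys) < unmatched 0 ((true ∷ ys) ++ zeros)
  fewer = begin-strict
    unmatched 0 (zeros ++ true ∷ ys)  ≡⟨ unmatched-zeros-++ (suc a) 0 (true ∷ ys) ⟩
    unmatched (a + 0) ys              ≤⟨ unmatched-≤-unmatched₀ (a + 0) ys ⟩
    unmatched 0 ys                    <⟨ n<1+n _ ⟩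
    unmatched 0 (true ∷ ys)           ≤⟨ unmatched-++-≥ 0 (true ∷ ys) zeros ⟩
    unmatched 0 ((true ∷ ys) ++ zeros) ∎

RJ-¬trailing-ones : ∀ {n} {x : Bits (suc n)} → RJ (suc n) x →
                    ∀ xs a → ¬ (toList x ≡ xs ++ false ∷ List.replicate (suc a) true)
RJ-¬trailing-ones rj xs a eq =
  <⇒≱ fewer (RJ-rotate rj (xs ∷ʳ false) ones (trans eq (sym (∷ʳ-++ xs false ones))))
  where
  open ≤-Reasoning
  ones = List.replicate (suc a) true
  fewer : unmatched 0 ((xs ∷ʳ false) ++ ones) < unmatched 0 (ones ++ xs ∷ʳ false)
  fewer = begin-strict
    unmatched 0 ((xs ∷ʳ false) ++ ones)   ≡⟨ cong (unmatched 0) (∷ʳ-++ xs false ones) ⟩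
    unmatched 0 (xs ++ false ∷ ones)      ≤⟨ unmatched-++-≤ 0 xs (false ∷ ones) ⟩
    unmatched 0 xs + unmatched 1 ones     ≡⟨ cong (unmatched 0 xs +_) (unmatched-ones a) ⟩
    unmatched 0 xs + a                    ≡⟨ +-comm (unmatched 0 xs) a ⟩
    a + unmatched 0 xs                    <⟨ n<1+n _ ⟩
    suc a + unmatched 0 xs                ≤⟨ +-monoʳ-≤ (suc a) (unmatched-++-≥ 0 xs [ false ]) ⟩
    suc a + unmatched 0 (xs ∷ʳ false)     ≡⟨ unmatched-ones-++ (suc a) (xs ∷ʳ false) ⟨
    unmatched 0 (ones ++ xs ∷ʳ false)     ∎

lemma19 : ∀ (n : ℕ) (x : Bits (suc n)) → RJ (suc n) x →
    ¬ (x ≡ replicate (suc n) false) → ¬ (x ≡ replicate (suc n) true) →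
    FiniteBlockCode x
lemma19 n x rj x≢0ⁿ x≢1ⁿ = head≡1 , last≡0
  where
  head≡1 : head x ≡ true
  head≡1 with replicate-⊎-leading-zeros x
  ... | inj₁ x≡0ⁿ             = ⊥-elim (x≢0ⁿ x≡0ⁿ)
  ... | inj₂ (zero , ys , eq)  = head-≡ x eq
  ... | inj₂ (suc a , ys , eq) = ⊥-elim (RJ-¬leading-zeros rj a ys eq)

  last≡0 : last x ≡ false
  last≡0 with replicate-⊎-trailing-ones x
  ... | inj₁ x≡1ⁿ             = ⊥-elim (x≢1ⁿ x≡1ⁿ)
  ... | inj₂ (xs , zero , eq)  = proj₂ (toList-≡-∷ʳ x eq)
  ... | inj₂ (xs , suc a , eq) = ⊥-elim (RJ-¬trailing-ones rj xs a eq)
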